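{- $\omega_1$ is the least ordinal admitting no good graph.
   Context: A graph on an ordinal $\gamma$ is a simple undirected graph with vertex set $\gamma$. Such a graph $G$ is good if $G$ has no cycles and, for every $\alpha<\gamma$, the induced subgraph $G|_{[\alpha,\gamma)}$ on the vertex set $[\alpha,\gamma)$ is connected. -}

module Defs where

open import Level using (0ℓ)
open import Data.Nat using (ℕ; suc)
open import Data.Fin using (Fin; zero; inject₁; fromℕ)
import Data.Fin as Fin
open import Data.Product using (Σ; _×_)
open import Data.Empty using (⊥)
open import Relation.Nullary using (¬_)
open import Relation.Binary using (Rel; Trichotomous; Transitive)
open import Relation.Binary.PropositionalEquality using (_≡_)
open import Induction.WellFounded using (WellFounded)
open import Function.Definitions using (Injective)

-- An ordinal, represented (up to order-isomorphism) by a well-order: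
-- a strict, transitive, trichotomous, well-founded relation on a type.
record Ordinal : Set₁ where
  field
    Carrier : Set
    _<_     : Rel Carrier 0ℓ
    <-trans : Transitive _<_
    <-tri   : Trichotomous _≡_ _<_
    <-wf    : WellFounded _<_

record Graph (V : Set) : Set₁ where
  field
    Adj     : V → V → Set
    Adj-sym : ∀ {x y} → Adj x y → Adj y x
    Adj-irr : ∀ {x} → ¬ Adj x x

module _ {V : Set} (G : Graph V) where
  open Graph G

  -- A cycle: n ≥ 3 pairwise distinct vertices v₀ … v_{n-1} with
  -- v_i ~ v_{i+1} and v_{n-1} ~ v₀.
  record Cycle : Set where
    field
      m     : ℕ
      v     : Fin (suc (suc (suc m))) → V
      v-inj : Injective _≡_ _≡_ v
      step  : (i : Fin (suc (suc m))) → Adj (v (inject₁ i)) (v (Fin.suc i))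
      close : Adj (v (fromℕ (suc (suc m)))) (v zero)

  Acyclic : Set
  Acyclic = ¬ Cycle

  data Walk (P : V → Set) : V → V → Set where
    here : ∀ {x} → Walk P x x
    step : ∀ {x y z} → Adj x z → P z → Walk P z y → Walk P x y

  InducedConnected : (V → Set) → Set
  InducedConnected P = ∀ x y → P x → P y → Walk P x y

module _ (γ : Ordinal) where
  open Ordinal γ

  IsGood : Graph Carrier → Set
  IsGood G = Acyclic G × (∀ α → InducedConnected G (λ x → ¬ (x < α)))

  AdmitsGoodGraph : Set₁
  AdmitsGoodGraph = Σ (Graph Carrier) IsGood

  Countable : Set
  Countable = Σ (Carrier → ℕ) (Injective _≡_ _≡_)

  CountableBelow : Carrier → Set
  CountableBelow a = Σ (Σ Carrier (λ x → x < a) → ℕ) (Injective _≡_ _≡_)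

  -- γ is (order type) ω₁: uncountable, but every proper initial segment is countable.
  IsOmega1 : Set
  IsOmega1 = ¬ Countable × (∀ a → CountableBelow a)

module Submission where

-- If γ is countable, fix an injection f into ℕ and join every x to its parent, the element above x
-- of least f-value. Each vertex then has at most one neighbour above it, so the least vertex of a
-- cycle would have two, and there are no cycles. Given x, y ≥ α, let m ≥ x, y have least f-value;
-- then m is a record of f (no later element has smaller f-value), parents of elements below m
-- stay ≤ m, and along a chain of parents f strictly increases, so following parents from x and
-- from y reaches m inside [α, γ).
--
-- Conversely, in a good graph every vertex u has at most one neighbour above it: two of them are
-- joined by a path in [s, γ), where s is the least element above u, closing a cycle through u.
-- Hence if initial segments are countable, so is the set obtained from [0, x₀] by alternately
-- adding upper neighbours and closing downwards, ω times. That set is closed under adjacency and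
-- so, by connectedness of [x₀, γ), is all of γ.

open import Defs
open import Level using (0ℓ)
open import Data.Nat using (ℕ; _≤_)
open import Data.Nat.Properties using (≮⇒≥)
open import Data.Nat.Induction using (<-wellFounded)
open import Data.Product using (Σ; Σ-syntax; ∃; _×_; _,_; proj₁; proj₂)
import Data.Fin as Fin
open import Data.Sum using (_⊎_; inj₁; inj₂; swap)
open import Relation.Nullary using (¬_; Dec; yes; no; contradiction)
open import Relation.Binary using (Rel; tri<; tri≈; tri>)
open import Relation.Binary.PropositionalEquality using (_≡_; _≢_; refl; sym; trans; cong; subst)
open import Relation.Binary.Construct.On as On using ()
open import Relation.Binary.Consequences using (tri⇒irr; tri⇒asym)
open import Induction.WellFounded using (WellFounded; Acc; acc)
open import Function.Definitions using (Injective)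
open import Axiom.ExcludedMiddle using (ExcludedMiddle)

module _ (em : ExcludedMiddle 0ℓ) where

  minimal : {A : Set} {_<_ : Rel A 0ℓ} → WellFounded _<_ → (P : A → Set) → ∀ {x} → P x →
            Σ[ m ∈ A ] P m × (∀ {z} → P z → ¬ z < m)
  minimal {A} {_<_} wf P {x} = go x (wf x)
    where
    go : ∀ x → Acc _<_ x → P x → Σ[ m ∈ A ] P m × (∀ {z} → P z → ¬ z < m)
    go x (acc smaller) px with em {Σ[ z ∈ A ] P z × z < x}
    ... | yes (z , pz , z<x) = go z (smaller z<x) pz
    ... | no ∄smaller = x , px , λ pz z<x → ∄smaller (_ , pz , z<x)

  argmin : {A : Set} (f : A → ℕ) (P : A → Set) → ∀ {x} → P x →
           Σ[ m ∈ A ] P m × (∀ {z} → P z → f m ≤ f z)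
  argmin f P px with minimal (On.wellFounded f <-wellFounded) P px
  ... | m , pm , m-min = m , pm , λ pz → ≮⇒≥ (m-min pz)

module Pairing where
  open import Data.Nat using (zero; suc; pred)

  double : ℕ → ℕ
  double zero    = zero
  double (suc n) = suc (suc (double n))

  double-injective : ∀ {m n} → double m ≡ double n → m ≡ n
  double-injective {zero}  {zero}  _  = refl
  double-injective {suc m} {suc n} eq = cong suc (double-injective (cong (λ k → pred (pred k)) eq))

  double≢suc-double : ∀ m n → double m ≢ suc (double n)
  double≢suc-double zero    _       ()
  double≢suc-double (suc m) zero    ()
  double≢suc-double (suc m) (suc n) eq = double≢suc-double m n (cong (λ k → pred (pred k)) eq)

  -- pair a b = 2ᵃ(2b + 1) − 1
  pair : ℕ → ℕ → ℕ
  pair zero    b = double b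
  pair (suc a) b = suc (double (pair a b))

  pair-injective : ∀ {a b a′ b′} → pair a b ≡ pair a′ b′ → a ≡ a′ × b ≡ b′
  pair-injective {zero}  {b} {zero}   eq = refl , double-injective eq
  pair-injective {zero}  {b} {suc a′} eq = contradiction eq (double≢suc-double b _)
  pair-injective {suc a} {b} {zero}   eq = contradiction (sym eq) (double≢suc-double _ _)
  pair-injective {suc a} {b} {suc a′} eq with pair-injective {a} {a′ = a′} (double-injective (cong pred eq))
  ... | refl , b≡b′ = refl , b≡b′

module _ {V : Set} (G : Graph V) where
  open import Data.Nat using (zero; suc)
  open import Data.Fin using (Fin; zero; suc; inject₁; fromℕ)
  open import Data.Fin.Properties using (suc-injective)
  open import Data.Fin.Relation.Unary.Top using (view; ‵fromℕ; ‵inject₁)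
  open Graph G

  module _ {P : V → Set} where

    snoc : ∀ {x y z} → Walk G P x y → Adj y z → P z → Walk G P x z
    snoc here           y~z pz = step y~z pz here
    snoc (step x~w pw W) y~z pz = step x~w pw (snoc W y~z pz)

    reverse : ∀ {x y} → P x → Walk G P x y → Walk G P y x
    reverse px here            = here
    reverse px (step x~z pz W) = snoc (reverse pz W) (Adj-sym x~z) px

    append : ∀ {x y z} → Walk G P x y → Walk G P y z → Walk G P x z
    append here            W′ = W′
    append (step x~w pw W) W′ = step x~w pw (append W W′)

    length : ∀ {x y} → Walk G P x y → ℕ
    length here         = zero
    length (step _ _ W) = suc (length W)

    vertex : ∀ {x y} (W : Walk G P x y) → Fin (suc (length W)) → V
    vertex {x} W            zero    = x
    vertex     (step _ _ W) (suc i) = vertex W i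

    vertex-last : ∀ {x y} (W : Walk G P x y) → vertex W (fromℕ (length W)) ≡ y
    vertex-last here         = refl
    vertex-last (step _ _ W) = vertex-last W

    vertex-step : ∀ {x y} (W : Walk G P x y) (i : Fin (length W)) →
                  Adj (vertex W (inject₁ i)) (vertex W (suc i))
    vertex-step (step x~z _ _) zero    = x~z
    vertex-step (step _ _ W)   (suc i) = vertex-step W i

    vertex-∈ : ∀ {x y} → P x → (W : Walk G P x y) → ∀ i → P (vertex W i)
    vertex-∈ px W            zero    = px
    vertex-∈ _  (step _ pz W) (suc i) = vertex-∈ pz W i

    Simple : ∀ {x y} → Walk G P x y → Set
    Simple W = Injective _≡_ _≡_ (vertex W)

    suffix : ∀ {x y z} (W : Walk G P z y) → Simple W →
             (i : Fin (suc (length W))) → vertex W i ≡ x → Σ[ W′ ∈ Walk G P x y ] Simple W′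
    suffix W            simple zero    refl = W , simple
    suffix (step _ _ W) simple (suc i) eq   = suffix W (λ e → suc-injective (simple e)) i eq

    simplify : ExcludedMiddle 0ℓ → ∀ {x y} → Walk G P x y → Σ[ W′ ∈ Walk G P x y ] Simple W′
    simplify em here = here , λ { {zero} {zero} _ → refl }
    simplify em {x} (step x~z pz W) with simplify em W
    ... | W′ , simple with em {Σ[ i ∈ Fin (suc (length W′)) ] vertex W′ i ≡ x}
    ... | yes (i , eq) = suffix W′ simple i eq
    ... | no x∉W′      = step x~z pz W′ , cons-simple
      where
      cons-simple : Simple (step x~z pz W′)
      cons-simple {zero}  {zero}  _  = refl
      cons-simple {zero}  {suc j} eq = contradiction (j , sym eq) x∉W′
      cons-simple {suc i} {zero}  eq = contradiction (i , eq) x∉W′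
      cons-simple {suc i} {suc j} eq = cong suc (simple eq)

    cycle-through : ExcludedMiddle 0ℓ → ∀ {u w w′} → Adj u w → Adj w′ u → w ≢ w′ →
                    P w → (∀ {z} → P z → z ≢ u) → Walk G P w w′ → Cycle G
    cycle-through em {u} u~w w′~u w≢w′ pw avoids W with simplify em W
    ... | here , _ = contradiction refl w≢w′
    ... | W′@(step _ _ R) , simple = record
      { m = length R ; v = v ; v-inj = v-inj ; step = v-step ; close = v-close }
      where
      v : Fin (suc (suc (suc (length R)))) → V
      v zero    = u
      v (suc i) = vertex W′ i

      avoids-u : ∀ i → vertex W′ i ≢ u
      avoids-u i = avoids (vertex-∈ pw W′ i)

      v-inj : Injective _≡_ _≡_ v
      v-inj {zero}  {zero}  _  = refl
      v-inj {zero}  {suc j} eq = contradiction (sym eq) (avoids-u j)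
      v-inj {suc i} {zero}  eq = contradiction eq (avoids-u i)
      v-inj {suc i} {suc j} eq = cong suc (simple eq)

      v-step : ∀ i → Adj (v (inject₁ i)) (v (suc i))
      v-step zero    = u~w
      v-step (suc i) = vertex-step W′ i

      v-close : Adj (v (fromℕ (suc (suc (length R))))) u
      v-close = subst (λ t → Adj t u) (sym (vertex-last W′)) w′~u

  suc²≢inject₁² : ∀ {n} (i : Fin n) → Fin.suc (suc i) ≢ inject₁ (inject₁ i)
  suc²≢inject₁² zero    ()
  suc²≢inject₁² (suc i) eq = suc²≢inject₁² i (suc-injective eq)

  module _ (C : Cycle G) where
    open Cycle C renaming (step to edge)

    two-neighbours : ∀ i → Σ[ s ∈ Fin _ ] Σ[ r ∈ Fin _ ] s ≢ r × Adj (v i) (v s) × Adj (v i) (v r)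
    two-neighbours zero = suc zero , fromℕ _ , (λ ()) , edge zero , Adj-sym close
    two-neighbours (suc j) with view j
    ... | ‵fromℕ     = zero , inject₁ j , (λ ()) , close , Adj-sym (edge j)
    ... | ‵inject₁ k = suc (suc k) , inject₁ (inject₁ k) , suc²≢inject₁² k ,
                       edge (suc k) , Adj-sym (edge (inject₁ k))

module _ (γ : Ordinal) where
  open Ordinal γ

  <-irrefl : ∀ {x} → ¬ x < x
  <-irrefl = tri⇒irr <-tri refl

  <-asym : ∀ {x y} → x < y → ¬ y < x
  <-asym = tri⇒asym <-tri

  ≮⇒>⊎≡ : ∀ {x y} → ¬ x < y → y < x ⊎ y ≡ x
  ≮⇒>⊎≡ {x} {y} x≮y with <-tri x y
  ... | tri< x<y _ _ = contradiction x<y x≮y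
  ... | tri≈ _ x≡y _ = inj₂ (sym x≡y)
  ... | tri> _ _ y<x = inj₁ y<x

  upper-bound : ∀ x y → Σ[ z ∈ Carrier ] ¬ z < x × ¬ z < y
  upper-bound x y with <-tri x y
  ... | tri< x<y _ _ = y , <-asym x<y , <-irrefl
  ... | tri≈ _ refl _ = x , <-irrefl , <-irrefl
  ... | tri> _ _ y<x = x , <-irrefl , <-asym y<x

  module _ (G : Graph Carrier) where
    open Graph G

    UniqueUpperNeighbours : Set
    UniqueUpperNeighbours = ∀ {u w w′} → Adj u w → u < w → Adj u w′ → u < w′ → w ≡ w′

    unique-upper⇒acyclic : ExcludedMiddle 0ℓ → UniqueUpperNeighbours → Acyclic G
    unique-upper⇒acyclic em unique C
      with minimal em <-wf (λ x → ∃ λ i → Cycle.v C i ≡ x) (Fin.zero , refl)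
    ... | _ , (i , refl) , v-i-least with two-neighbours G C i
    ... | s , r , s≢r , i~s , i~r = s≢r (v-inj (unique i~s (upper i~s) i~r (upper i~r)))
      where
      open Cycle C
      upper : ∀ {j} → Adj (v i) (v j) → v i < v j
      upper {j} i~j with <-tri (v i) (v j)
      ... | tri< i<j _ _ = i<j
      ... | tri≈ _ i≡j _ = contradiction (subst (Adj (v i)) (sym i≡j) i~j) Adj-irr
      ... | tri> _ _ j<i = contradiction j<i (v-i-least (j , refl))

module ParentGraph (em : ExcludedMiddle 0ℓ) (γ : Ordinal)
                   (f : Ordinal.Carrier γ → ℕ) (f-injective : Injective _≡_ _≡_ f) where
  open import Data.Nat using (zero; suc; _+_) renaming (_<_ to _<ℕ_)
  open import Data.Nat.Properties using (≤∧≢⇒<; <⇒≱; ≤-antisym; ≤-trans; +-monoʳ-<; m≤m+n)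
  open Ordinal γ

  IsRecord : Carrier → Set
  IsRecord y = ∀ {z} → y < z → f y ≤ f z

  IsParent : Carrier → Carrier → Set
  IsParent x p = x < p × (∀ {z} → x < z → f p ≤ f z)

  parent-unique : ∀ {x p p′} → IsParent x p → IsParent x p′ → p ≡ p′
  parent-unique (x<p , p-min) (x<p′ , p′-min) = f-injective (≤-antisym (p-min x<p′) (p′-min x<p))

  parent-isRecord : ∀ {x p} → IsParent x p → IsRecord p
  parent-isRecord (x<p , p-min) p<z = p-min (<-trans x<p p<z)

  record-increases : ∀ {y z} → IsRecord y → y < z → f y <ℕ f z
  record-increases y-rec y<z =
    ≤∧≢⇒< (y-rec y<z) (λ fy≡fz → <-irrefl γ (subst (_< _) (f-injective fy≡fz) y<z))

  parent-below : ∀ {m y} → IsRecord m → y < m → Σ[ p ∈ Carrier ] IsParent y p × ¬ m < p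
  parent-below {m} m-rec y<m with argmin em f (_ <_) y<m
  ... | p , y<p , p-min = p , (y<p , p-min) , λ m<p →
    <-irrefl γ (subst (m <_) (f-injective (≤-antisym (p-min y<m) (m-rec m<p))) m<p)

  record-above : ∀ x y → Σ[ m ∈ Carrier ] IsRecord m × ¬ m < x × ¬ m < y
  record-above x y with argmin em f (λ z → ¬ z < x × ¬ z < y) (proj₂ (upper-bound γ x y))
  ... | m , (m≮x , m≮y) , m-min = m , m-rec , m≮x , m≮y
    where
    m-rec : IsRecord m
    m-rec m<z = m-min ((λ z<x → m≮x (<-trans m<z z<x)) , (λ z<y → m≮y (<-trans m<z z<y)))

  parentGraph : Graph Carrier
  parentGraph = record
    { Adj     = λ x y → IsParent x y ⊎ IsParent y x
    ; Adj-sym = swap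
    ; Adj-irr = λ { (inj₁ (x<x , _)) → <-irrefl γ x<x ; (inj₂ (x<x , _)) → <-irrefl γ x<x }
    }
  open Graph parentGraph using (Adj)

  upper-neighbour-is-parent : ∀ {u w} → Adj u w → u < w → IsParent u w
  upper-neighbour-is-parent (inj₁ u↑w)       _   = u↑w
  upper-neighbour-is-parent (inj₂ (w<u , _)) u<w = contradiction w<u (<-asym γ u<w)

  parentGraph-acyclic : Acyclic parentGraph
  parentGraph-acyclic = unique-upper⇒acyclic γ parentGraph em λ u~w u<w u~w′ u<w′ →
    parent-unique (upper-neighbour-is-parent u~w u<w) (upper-neighbour-is-parent u~w′ u<w′)

  module _ (α : Carrier) {m : Carrier} (m-rec : IsRecord m) where

    Segment : Carrier → Set
    Segment z = ¬ z < α

    segment-upward : ∀ {y z} → Segment y → y < z → Segment z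
    segment-upward y∈ y<z z<α = y∈ (<-trans y<z z<α)

    -- f increases strictly along a chain of parents below m and is bounded by f m: k is the fuel.
    climb : ∀ k {y} → IsRecord y → Segment y → ¬ m < y → f m ≤ k + f y →
            Walk parentGraph Segment y m
    climb-from : ∀ k {y} → IsRecord y → Segment y → y < m → f m ≤ k + f y →
                 Walk parentGraph Segment y m

    climb k y-rec y∈ m≮y bound with ≮⇒>⊎≡ γ m≮y
    ... | inj₂ refl = here
    ... | inj₁ y<m  = climb-from k y-rec y∈ y<m bound

    climb-from zero    y-rec _  y<m bound = contradiction bound (<⇒≱ (record-increases y-rec y<m))
    climb-from (suc k) y-rec y∈ y<m bound with parent-below m-rec y<m
    ... | p , y↑p@(y<p , _) , m≮p =
      step (inj₁ y↑p) (segment-upward y∈ y<p)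
           (climb k (parent-isRecord y↑p) (segment-upward y∈ y<p) m≮p
                  (≤-trans bound (+-monoʳ-< k (record-increases y-rec y<p))))

    reach : ∀ {x} → Segment x → ¬ m < x → Walk parentGraph Segment x m
    reach x∈ m≮x with ≮⇒>⊎≡ γ m≮x
    ... | inj₂ refl = here
    ... | inj₁ x<m with parent-below m-rec x<m
    ... | p , x↑p@(x<p , _) , m≮p =
      step (inj₁ x↑p) (segment-upward x∈ x<p)
           (climb (f m) (parent-isRecord x↑p) (segment-upward x∈ x<p) m≮p (m≤m+n (f m) (f p)))

  parentGraph-connected : ∀ α → InducedConnected parentGraph (λ x → ¬ x < α)
  parentGraph-connected α x y x∈ y∈ with record-above x y
  ... | m , m-rec , m≮x , m≮y =
    append parentGraph (reach α m-rec x∈ m≮x) (reverse parentGraph y∈ (reach α m-rec y∈ m≮y))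

  parentGraph-good : IsGood γ parentGraph
  parentGraph-good = parentGraph-acyclic , parentGraph-connected

IsCountable : {A : Set} → (A → Set) → Set
IsCountable {A} S = Σ[ code ∈ (A → ℕ) ] (∀ {x y} → S x → S y → code x ≡ code y → x ≡ y)

module _ {A : Set} where

  countable-mono : {S S′ : A → Set} → IsCountable S → (∀ {x} → S′ x → S x) → IsCountable S′
  countable-mono (code , code-inj) S′⊆S = code , λ s′x s′y → code-inj (S′⊆S s′x) (S′⊆S s′y)

  subsingleton-countable : {S : A → Set} → (∀ {x y} → S x → S y → x ≡ y) → IsCountable S
  subsingleton-countable unique = (λ _ → 0) , λ sx sy _ → unique sx sy

  module _ (em : ExcludedMiddle 0ℓ) where

    witnessed-code⇒countable : (S : A → Set) (code : ∀ x → S x → ℕ) →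
      (∀ {x y} (sx : S x) (sy : S y) → code x sx ≡ code y sy → x ≡ y) → IsCountable S
    witnessed-code⇒countable S code code-inj = code′ , code′-inj
      where
      decided-code : ∀ x → Dec (S x) → ℕ
      decided-code x (yes sx) = code x sx
      decided-code x (no _)   = 0

      code′ : A → ℕ
      code′ x = decided-code x em

      decided-code-inj : ∀ {x y} → S x → S y → (dx : Dec (S x)) (dy : Dec (S y)) →
                         decided-code x dx ≡ decided-code y dy → x ≡ y
      decided-code-inj _  _  (yes sx) (yes sy) = code-inj sx sy
      decided-code-inj sx _  (no ¬sx) _        = contradiction sx ¬sx
      decided-code-inj _  sy (yes _)  (no ¬sy) = contradiction sy ¬sy

      code′-inj : ∀ {x y} → S x → S y → code′ x ≡ code′ y → x ≡ y
      code′-inj sx sy = decided-code-inj sx sy em em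

    countable-⋃ℕ : (T : ℕ → A → Set) → (∀ n → IsCountable (T n)) → IsCountable (λ x → ∃ λ n → T n x)
    countable-⋃ℕ T countable = witnessed-code⇒countable _
      (λ x (n , _) → Pairing.pair n (proj₁ (countable n) x))
      λ { (n , tx) (n′ , ty) eq → lemma tx ty (Pairing.pair-injective eq) }
      where
      lemma : ∀ {n n′ x y} → T n x → T n′ y →
              n ≡ n′ × proj₁ (countable n) x ≡ proj₁ (countable n′) y → x ≡ y
      lemma {n} tx ty (refl , eq) = proj₂ (countable n) tx ty eq

    countable-∪ : {S S′ : A → Set} → IsCountable S → IsCountable S′ → IsCountable (λ x → S x ⊎ S′ x)
    countable-∪ {S} {S′} countable countable′ = countable-mono (countable-⋃ℕ T countable-T) S∪S′⊆⋃T
      where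
      T : ℕ → A → Set
      T 0         = S
      T (ℕ.suc _) = S′
      countable-T : ∀ n → IsCountable (T n)
      countable-T 0         = countable
      countable-T (ℕ.suc _) = countable′
      S∪S′⊆⋃T : ∀ {x} → S x ⊎ S′ x → ∃ λ n → T n x
      S∪S′⊆⋃T (inj₁ sx)  = 0 , sx
      S∪S′⊆⋃T (inj₂ s′x) = 1 , s′x

    countable-⋃ : {I : Set} {U : I → Set} {R : I → A → Set} → IsCountable U →
                  (∀ {t} → U t → IsCountable (R t)) → IsCountable (λ z → Σ[ t ∈ I ] U t × R t z)
    countable-⋃ {I} {U} {R} (code , code-inj) countable-R =
      countable-mono (countable-⋃ℕ Piece countable-Piece) λ (t , ut , r) → code t , t , ut , refl , r
      where
      Piece : ℕ → A → Set
      Piece n z = Σ[ t ∈ I ] U t × code t ≡ n × R t z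

      countable-Piece : ∀ n → IsCountable (Piece n)
      countable-Piece n with em {Σ[ t ∈ I ] U t × code t ≡ n}
      ... | yes (t , ut , refl) = countable-mono (countable-R ut) λ (t′ , ut′ , eq , r) →
        subst (λ s → R s _) (code-inj ut′ ut eq) r
      ... | no ∄t = subsingleton-countable λ (t , ut , eq , _) _ → contradiction (t , ut , eq) ∄t

module _ (em : ExcludedMiddle 0ℓ) (γ : Ordinal) (G : Graph (Ordinal.Carrier γ)) (good : IsGood γ G) where
  open Ordinal γ
  open Graph G

  -- [s, γ) with s least above u contains w and w′ but not u.
  good⇒unique-upper : UniqueUpperNeighbours γ G
  good⇒unique-upper {u} {w} {w′} u~w u<w u~w′ u<w′ with em {w ≡ w′}
  ... | yes w≡w′ = w≡w′
  ... | no w≢w′ with minimal em <-wf (u <_) u<w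
  ... | s , u<s , s-least = contradiction cycle (proj₁ good)
    where
    avoids-u : ∀ {z} → ¬ z < s → z ≢ u
    avoids-u z≮s refl = z≮s u<s

    cycle : Cycle G
    cycle = cycle-through G em u~w (Adj-sym u~w′) w≢w′ (s-least u<w) avoids-u
              (proj₂ good s w w′ (s-least u<w) (s-least u<w′))

  module _ (countable-below : ∀ a → CountableBelow γ a) where

    Down : (Carrier → Set) → Carrier → Set
    Down U z = Σ[ t ∈ Carrier ] U t × ¬ t < z

    Up : (Carrier → Set) → Carrier → Set
    Up U w = Σ[ u ∈ Carrier ] U u × (Adj u w × u < w)

    countable-< : ∀ a → IsCountable (_< a)
    countable-< a = witnessed-code⇒countable em (_< a)
      (λ x x<a → proj₁ (countable-below a) (x , x<a))
      (λ _ _ eq → cong proj₁ (proj₂ (countable-below a) eq))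

    countable-≡ : ∀ a → IsCountable {Carrier} (_≡ a)
    countable-≡ a = subsingleton-countable λ x≡a y≡a → trans x≡a (sym y≡a)

    countable-≤ : ∀ a → IsCountable (λ z → ¬ a < z)
    countable-≤ a = countable-mono (countable-∪ em (countable-< a) (countable-≡ a)) (≮⇒>⊎≡ γ)

    countable-Down : ∀ {U} → IsCountable U → IsCountable (Down U)
    countable-Down countable = countable-⋃ em countable λ {t} _ → countable-≤ t

    countable-Up : ∀ {U} → IsCountable U → IsCountable (Up U)
    countable-Up countable = countable-⋃ em countable λ _ → subsingleton-countable
      λ (u~w , u<w) (u~w′ , u<w′) → good⇒unique-upper u~w u<w u~w′ u<w′

    module _ (x₀ : Carrier) where

      Layer : ℕ → Carrier → Set
      Layer 0         = _≡ x₀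
      Layer (ℕ.suc n) = Up (Down (Layer n))

      Reached : Carrier → Set
      Reached z = ∃ λ n → Down (Layer n) z

      countable-Layer : ∀ n → IsCountable (Layer n)
      countable-Layer 0         = countable-≡ x₀
      countable-Layer (ℕ.suc n) = countable-Up (countable-Down (countable-Layer n))

      countable-Reached : IsCountable Reached
      countable-Reached = countable-⋃ℕ em _ λ n → countable-Down (countable-Layer n)

      reached-step : ∀ {a c} → Reached a → Adj a c → Reached c
      reached-step {a} {c} (n , t , lt , t≮a) a~c with <-tri a c
      ... | tri< a<c _ _  = ℕ.suc n , c , (a , (t , lt , t≮a) , a~c , a<c) , <-irrefl γ
      ... | tri≈ _ refl _ = contradiction a~c Adj-irr
      ... | tri> _ _ c<a  = n , t , lt , λ t<c → t≮a (<-trans t<c c<a)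

      reached-walk : ∀ {P a b} → Walk G P a b → Reached a → Reached b
      reached-walk here            ra = ra
      reached-walk (step a~c _ W) ra = reached-walk W (reached-step ra a~c)

      everything-reached : ∀ y → Reached y
      everything-reached y with em {Reached y}
      ... | yes ry = ry
      ... | no ¬ry = contradiction (reached-walk (proj₂ good x₀ x₀ y (<-irrefl γ) y≮x₀) x₀-reached) ¬ry
        where
        x₀-reached : Reached x₀
        x₀-reached = 0 , x₀ , refl , <-irrefl γ
        y≮x₀ : ¬ y < x₀
        y≮x₀ y<x₀ = ¬ry (0 , x₀ , refl , <-asym γ y<x₀)

    good⇒countable : Countable γ
    good⇒countable with em {Carrier}
    ... | no ∄x  = (λ x → contradiction x ∄x) , λ {x} _ → contradiction x ∄x
    ... | yes x₀ = code , λ eq → code-inj (everything-reached x₀ _) (everything-reached x₀ _) eq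
      where open Σ (countable-Reached x₀) renaming (proj₁ to code; proj₂ to code-inj)

open import Level using (suc)

theorem3p3 : ExcludedMiddle 0ℓ → ExcludedMiddle (suc 0ℓ) →
    ((γ : Ordinal) → Countable γ → AdmitsGoodGraph γ)
    × ((γ : Ordinal) → IsOmega1 γ → ¬ AdmitsGoodGraph γ)
theorem3p3 em _ =
  (λ γ (f , f-injective) → let open ParentGraph em γ f f-injective in parentGraph , parentGraph-good) ,
  (λ γ (uncountable , countable-below) (G , good) → uncountable (good⇒countable em γ G good countable-below))
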